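{- For all integers $d,k\geq 2$ we have \[\mathrm{ex}(n,K^{(k)}_{d,d,\ldots,d})\geq\Omega_k\left(n^{k-k/d^{k-1}}\right),\] and $d_1(K^{(k)}_{d,d,\ldots,d})=(k-1)d$.
   Context: $K^{(k)}_{d,\ldots,d}$ is the complete $k$-partite $k$-uniform hypergraph with $k$ parts of size $d$ (all $d^k$ $k$-sets meeting each part in one vertex are edges). $\mathrm{ex}(n,H)$ is the maximum number of edges in an $n$-vertex $k$-uniform hypergraph with no copy of $H$. The skeletal degeneracy $d_1(H)$ is the degeneracy of the $1$-skeleton of $H$ (the graph on $V(H)$ joining two vertices iff they lie in a common edge of $H$), i.e. the least $d$ such that every subgraph of that graph has minimum degree at most $d$. $\Omega_k(f(n))$ denotes a quantity at least $cf(n)$ for a constant $c>0$ depending only on $k$ (for all sufficiently large $n$). -}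

module Defs where

open import Data.Nat using (ℕ; zero; suc; _+_; _*_; _∸_; _^_; _≤_; _<_)
open import Data.Bool using (Bool; true; false)
open import Data.Fin using (Fin)
import Data.Fin as F
open import Data.Fin.Subset using (Subset; ⁅_⁆; _∪_; ∣_∣)
import Data.Fin.Subset as S
open import Data.Product using (Σ; ∃; _×_; _,_; proj₁; proj₂; uncurry)
open import Data.List using (List; length)
open import Data.List.Membership.Propositional using (_∈_)
open import Data.List.Relation.Unary.All using (All)
open import Data.List.Relation.Unary.Unique.Propositional using (Unique)
open import Function.Definitions using (Injective)
open import Relation.Binary.PropositionalEquality using (_≡_; _≢_)
open import Relation.Nullary using (¬_)

record UniformHypergraph (k n : ℕ) : Set where
  field
    edges   : List (Subset n)
    unique  : Unique edges
    uniform : All (λ e → ∣ e ∣ ≡ k) edges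
open UniformHypergraph public

numEdges : ∀ {k n} → UniformHypergraph k n → ℕ
numEdges G = length (edges G)

image : ∀ {m n} → (Fin m → Fin n) → Subset n
image {zero}  h = S.⊥
image {suc m} h = ⁅ h F.zero ⁆ ∪ image (λ i → h (F.suc i))

-- K^{(k)}_{d,...,d}: vertex set Fin k × Fin d (part i = {i} × Fin d);
-- edges are exactly the transversals {(i , g i) | i : Fin k} for
-- g : Fin k → Fin d.

CopyOfK : ∀ {k n} (d : ℕ) → UniformHypergraph k n → Set
CopyOfK {k} {n} d G =
  Σ (Fin k → Fin d → Fin n) λ f →
    Injective _≡_ _≡_ (uncurry f) ×
    ((g : Fin k → Fin d) → image (λ i → f i (g i)) ∈ edges G)

KFree : ∀ {k n} (d : ℕ) → UniformHypergraph k n → Set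
KFree d G = ¬ CopyOfK d G

ExAtLeast : (n k d m : ℕ) → Set
ExAtLeast n k d m = Σ (UniformHypergraph k n) λ G → KFree d G × m ≤ numEdges G

V : ℕ → ℕ → Set
V k d = Fin k × Fin d

SkelAdj : (k d : ℕ) → V k d → V k d → Set
SkelAdj k d u v =
  u ≢ v × Σ (Fin k → Fin d) λ g → (g (proj₁ u) ≡ proj₂ u) × (g (proj₁ v) ≡ proj₂ v)

countFin : ∀ {n} → (Fin n → Bool) → ℕ
countFin {zero}  p = 0
countFin {suc n} p with p F.zero
... | true  = suc (countFin (λ i → p (F.suc i)))
... | false = countFin (λ i → p (F.suc i))

countV : ∀ {k d} → (V k d → Bool) → ℕ
countV {zero}  p = 0
countV {suc k} p = countFin (λ a → p (F.zero , a)) + countV (λ v → p (F.suc (proj₁ v) , proj₂ v))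

record SkelSubgraph (k d : ℕ) : Set where
  field
    vert     : V k d → Bool
    edge     : V k d → V k d → Bool
    nonempty : ∃ λ v → vert v ≡ true
    symm     : ∀ u v → edge u v ≡ edge v u
    sub      : ∀ u v → edge u v ≡ true →
               (vert u ≡ true) × (vert v ≡ true) × SkelAdj k d u v
open SkelSubgraph public

degree : ∀ {k d} → SkelSubgraph k d → V k d → ℕ
degree H v = countV (edge H v)

MinDegAtMost : ∀ {k d} → SkelSubgraph k d → ℕ → Set
MinDegAtMost H D = ∃ λ v → (vert H v ≡ true) × (degree H v ≤ D)

SkelDegenerate : (k d D : ℕ) → Set
SkelDegenerate k d D = (H : SkelSubgraph k d) → MinDegAtMost H D

SkelDegeneracyIs : (k d D : ℕ) → Set
SkelDegeneracyIs k d D = SkelDegenerate k d D × (∀ D' → D' < D → ¬ SkelDegenerate k d D')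

-- The 1-skeleton of K^{(k)}_{d,…,d} joins exactly the pairs of vertices in different parts, so
-- every vertex of a subgraph has degree at most (k-1)d, with equality throughout the whole skeleton.
--
-- The lower bound is the deletion method, with probabilities replaced by exact counting over all
-- colourings. Put D = d^{k-1}, r = ⌊n^{1/D}⌋ and colour every subset of Fin n uniformly with
-- q = r^k colours, keeping the k-subsets of colour 0. A placement of K whose d^k edges are distinct
-- survives with probability q^{-d^k}, so on average at most n^{dk} q^{-d^k} ≤ 2^{k d^k} copies
-- survive, while C(n,k)/q ≈ (n/r)^k ≥ n^{k-k/D} edges do. Deleting one edge from every surviving
-- copy, some colouring keeps at least ⌊n/(4kr)⌋^k edges, which is Ω_k(n^{k-k/D}).
module Submission where

open import Algebra.Bundles using (CommutativeMonoid)
open import Algebra.Properties.CommutativeSemigroup using (x∙yz≈y∙xz; x∙yz≈yx∙z; interchange)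
open import Data.Bool using (Bool; true; false; not; _∧_; if_then_else_; T; T?)
import Data.Bool as Bool
open import Data.Bool.ListAction using (all)
open import Data.Bool.Properties using (∧-assoc; ∧-identityʳ; ∧-commutativeMonoid)
open import Data.Empty using (⊥; ⊥-elim)
open import Data.Fin using (Fin; zero; suc; toℕ; _≟_)
open import Data.Fin.Properties using (suc-injective)
open import Data.Fin.Subset using (Subset; ⁅_⁆; _∪_; ∣_∣; inside; outside)
import Data.Fin.Subset as Subset
open import Data.Fin.Subset.Properties using (x∈⁅x⁆; x∈⁅y⁆⇒x≡y; x∈p∪q⁺; x∈p∪q⁻; ∉⊥; ∣⊥∣≡0)
open import Data.List
  using (List; []; _∷_; length; map; filter; foldr; tabulate; allFin; cartesianProductWith; cartesianProduct; _++_)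
open import Data.List.Membership.Propositional using (_∈_; _∉_)
open import Data.List.Membership.Propositional.Properties
  using (∈-map⁺; ∈-map⁻; ∈-filter⁺; ∈-filter⁻; ∈-allFin; ∈-cartesianProductWith⁺)
open import Data.List.Properties using (length-++; length-map; length-tabulate; map-++; map-tabulate; filter-all)
open import Data.List.Relation.Unary.All using (All; []; _∷_)
import Data.List.Relation.Unary.All as All
import Data.List.Relation.Unary.All.Properties as All
open import Data.List.Relation.Unary.Any using (here; there; any?; satisfied)
open import Data.List.Relation.Unary.Unique.Propositional using (Unique; []; _∷_)
import Data.List.Relation.Unary.Unique.Propositional.Properties as Unique
open import Data.Nat
  using (ℕ; zero; suc; _+_; _*_; _∸_; _^_; _≤_; _≰_; _<_; _!; _≡ᵇ_; _≤?_; z≤n; s≤s; NonZero; >-nonZero; >-nonZero⁻¹)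
open import Data.Nat.Combinatorics using (_C_; nCk+nC[k+1]≡[n+1]C[k+1]; nC1≡n)
open import Data.Nat.DivMod using (_/_; _%_; m/n*n≤m; m≡m%n+[m/n]*n; m%n<n; m≥n⇒m/n>0)
open import Data.Nat.ListAction using (sum)
open import Data.Nat.ListAction.Properties using (sum-++)
open import Data.Nat.Properties hiding (_≟_; suc-injective)
open import Data.Nat.Tactic.RingSolver using (solve-∀)
open import Data.Product using (Σ; ∃; _×_; _,_; proj₁; proj₂; uncurry)
open import Data.Product.Properties using (,-injectiveˡ; ,-injectiveʳ)
open import Data.Sum using (inj₁; inj₂)
open import Data.Vec using (Vec; []; _∷_; lookup)
import Data.Vec as Vec
open import Data.Vec.Properties using (∷-injective; ∷-injectiveʳ; ≡-dec; lookup∘tabulate; tabulate∘lookup; tabulate-cong)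
open import Defs
open import Function using (_∘_)
open import Function.Definitions using (Injective)
open import Relation.Binary.Definitions using (DecidableEquality)
open import Relation.Binary.PropositionalEquality
open import Relation.Nullary using (¬_; ¬?; yes; no; does; contradiction)

-- Skeletal degeneracy

countFin-mono : ∀ {n} {p p′ : Fin n → Bool} →
                (∀ i → p i ≡ true → p′ i ≡ true) → countFin p ≤ countFin p′
countFin-mono {zero}  p⇒p′ = z≤n
countFin-mono {suc n} {p} {p′} p⇒p′ with p zero in eq | p′ zero in eq′
... | true  | true  = s≤s (countFin-mono (λ i → p⇒p′ (suc i)))
... | true  | false with () ← trans (sym (p⇒p′ zero eq)) eq′
... | false | true  = m≤n⇒m≤1+n (countFin-mono (λ i → p⇒p′ (suc i)))
... | false | false = countFin-mono (λ i → p⇒p′ (suc i))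

countFin-all : ∀ {n} {p : Fin n → Bool} → (∀ i → p i ≡ true) → countFin p ≡ n
countFin-all {zero}      p≡true = refl
countFin-all {suc n} {p} p≡true with p zero | p≡true zero
... | true | refl = cong suc (countFin-all (λ i → p≡true (suc i)))

countFin-none : ∀ {n} {p : Fin n → Bool} → (∀ i → p i ≡ false) → countFin p ≡ 0
countFin-none {zero}      none = refl
countFin-none {suc n} {p} none with p zero | none zero
... | false | refl = countFin-none (λ i → none (suc i))

countV-mono : ∀ {k d} {p p′ : V k d → Bool} →
              (∀ u → p u ≡ true → p′ u ≡ true) → countV p ≤ countV p′
countV-mono {zero}  p⇒p′ = z≤n
countV-mono {suc k} p⇒p′ = +-mono-≤ (countFin-mono (λ a → p⇒p′ (zero , a)))
                                    (countV-mono (λ (i , a) → p⇒p′ (suc i , a)))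

countV-all : ∀ {k d} {p : V k d → Bool} → (∀ u → p u ≡ true) → countV p ≡ k * d
countV-all {zero}  p≡true = refl
countV-all {suc k} p≡true = cong₂ _+_ (countFin-all (λ a → p≡true (zero , a)))
                                   (countV-all (λ (i , a) → p≡true (suc i , a)))

countV-outsidePart : ∀ {k d} (i : Fin (suc k)) {p : V (suc k) d → Bool} →
                     (∀ u → proj₁ u ≡ i → p u ≡ false) →
                     (∀ u → proj₁ u ≢ i → p u ≡ true) → countV p ≡ k * d
countV-outsidePart zero onPart offPart =
  cong₂ _+_ (countFin-none (λ a → onPart (zero , a) refl))
            (countV-all (λ (j , a) → offPart (suc j , a) λ ()))
countV-outsidePart {suc k} (suc i) onPart offPart =
  cong₂ _+_ (countFin-all (λ a → offPart (zero , a) λ ()))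
            (countV-outsidePart i (λ (j , a) eq → onPart (suc j , a) (cong suc eq))
                                  (λ (j , a) ne → offPart (suc j , a) (ne ∘ suc-injective)))

inOtherPart : ∀ {k d} → V k d → V k d → Bool
inOtherPart u v = not (does (proj₁ u ≟ proj₁ v))

inOtherPart-samePart : ∀ {k d} (u v : V k d) → proj₁ u ≡ proj₁ v → inOtherPart u v ≡ false
inOtherPart-samePart u v eq with proj₁ u ≟ proj₁ v
... | yes _ = refl
... | no ne = ⊥-elim (ne eq)

inOtherPart-otherPart : ∀ {k d} (u v : V k d) → proj₁ u ≢ proj₁ v → inOtherPart u v ≡ true
inOtherPart-otherPart u v ne with proj₁ u ≟ proj₁ v
... | yes eq = ⊥-elim (ne eq)
... | no _   = refl

inOtherPart-sound : ∀ {k d} (u v : V k d) → inOtherPart u v ≡ true → proj₁ u ≢ proj₁ v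
inOtherPart-sound u v other eq with () ← trans (sym other) (inOtherPart-samePart u v eq)

inOtherPart-sym : ∀ {k d} (u v : V k d) → inOtherPart u v ≡ inOtherPart v u
inOtherPart-sym u v with proj₁ u ≟ proj₁ v
... | yes eq = sym (inOtherPart-samePart v u (sym eq))
... | no ne  = sym (inOtherPart-otherPart v u (ne ∘ sym))

countV-inOtherPart : ∀ {k d} (v : V (suc k) d) → countV (inOtherPart v) ≡ k * d
countV-inOtherPart v = countV-outsidePart (proj₁ v)
  (λ u eq → inOtherPart-samePart v u (sym eq))
  (λ u ne → inOtherPart-otherPart v u (ne ∘ sym))

skelAdj⇒otherPart : ∀ {k d} {u v : V k d} → SkelAdj k d u v → proj₁ u ≢ proj₁ v
skelAdj⇒otherPart {u = i , a} {i , b} (u≢v , g , ga , gb) refl = u≢v (cong (i ,_) (trans (sym ga) gb))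

otherPart⇒skelAdj : ∀ {k d} {u v : V k d} → proj₁ u ≢ proj₁ v → SkelAdj k d u v
otherPart⇒skelAdj {k} {d} {i , a} {j , b} i≢j = i≢j ∘ cong proj₁ , g , gi , gj
  where
  g : Fin k → Fin d
  g x with x ≟ i
  ... | yes _ = a
  ... | no _  = b
  gi : g i ≡ a
  gi with i ≟ i
  ... | yes _  = refl
  ... | no i≢i = ⊥-elim (i≢i refl)
  gj : g j ≡ b
  gj with j ≟ i
  ... | yes j≡i = ⊥-elim (i≢j (sym j≡i))
  ... | no _    = refl

skelDegenerate : ∀ k d → SkelDegenerate (suc k) d (k * d)
skelDegenerate k d H with nonempty H
... | v , v∈H = v , v∈H , subst (degree H v ≤_) (countV-inOtherPart v)
  (countV-mono λ u vu∈H → inOtherPart-otherPart v u (skelAdj⇒otherPart (proj₂ (proj₂ (sub H v u vu∈H)))))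

skeleton : ∀ k d → SkelSubgraph (suc k) (suc d)
skeleton k d = record
  { vert     = λ _ → true
  ; edge     = inOtherPart
  ; nonempty = (zero , zero) , refl
  ; symm     = inOtherPart-sym
  ; sub      = λ u v uv → refl , refl , otherPart⇒skelAdj (inOtherPart-sound u v uv)
  }

¬skelDegenerate : ∀ k d D → D < k * suc d → ¬ SkelDegenerate (suc k) (suc d) D
¬skelDegenerate k d D D<kd degenerate with degenerate (skeleton k d)
... | v , _ , deg≤D = <⇒≱ D<kd (subst (_≤ D) (countV-inOtherPart v) deg≤D)

skelDegeneracy : ∀ k d → SkelDegeneracyIs (suc k) (suc d) (k * suc d)
skelDegeneracy k d = skelDegenerate k (suc d) , ¬skelDegenerate k d

private variable
  A B X : Set

∑ : List A → (A → ℕ) → ℕ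
∑ xs f = sum (map f xs)

infix 5 ∑
syntax ∑ xs (λ x → e) = ∑[ x ∈ xs ] e

indicator : Bool → ℕ
indicator b = if b then 1 else 0

indicator-∧ : ∀ a b → indicator (a ∧ b) ≡ indicator a * indicator b
indicator-∧ false b = refl
indicator-∧ true  b = sym (+-identityʳ (indicator b))

∑-cong : ∀ {f g : A → ℕ} xs → (∀ x → f x ≡ g x) → ∑ xs f ≡ ∑ xs g
∑-cong []       f≡g = refl
∑-cong (x ∷ xs) f≡g = cong₂ _+_ (f≡g x) (∑-cong xs f≡g)

∑-mono-≤ : ∀ {f g : A → ℕ} {xs} → All (λ x → f x ≤ g x) xs → ∑ xs f ≤ ∑ xs g
∑-mono-≤ []           = z≤n
∑-mono-≤ (fx≤gx ∷ f≤g) = +-mono-≤ fx≤gx (∑-mono-≤ f≤g)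

∑-const : ∀ (xs : List A) c → ∑[ x ∈ xs ] c ≡ length xs * c
∑-const []       c = refl
∑-const (x ∷ xs) c = cong (c +_) (∑-const xs c)

∑-zero : ∀ (xs : List A) → ∑[ x ∈ xs ] 0 ≡ 0
∑-zero xs = trans (∑-const xs 0) (*-zeroʳ (length xs))

*-distribˡ-∑ : ∀ c (f : A → ℕ) xs → c * ∑ xs f ≡ ∑[ x ∈ xs ] c * f x
*-distribˡ-∑ c f []       = *-zeroʳ c
*-distribˡ-∑ c f (x ∷ xs) = trans (*-distribˡ-+ c (f x) _) (cong (c * f x +_) (*-distribˡ-∑ c f xs))

∑-*ʳ : ∀ (f : A → ℕ) c xs → ∑ xs f * c ≡ ∑[ x ∈ xs ] f x * c
∑-*ʳ f c xs = trans (*-comm (∑ xs f) c) (trans (*-distribˡ-∑ c f xs) (∑-cong xs λ x → *-comm c (f x)))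

∑-distrib-+ : ∀ (f g : A → ℕ) xs → ∑[ x ∈ xs ] (f x + g x) ≡ ∑ xs f + ∑ xs g
∑-distrib-+ f g []       = refl
∑-distrib-+ f g (x ∷ xs) = trans (cong (f x + g x +_) (∑-distrib-+ f g xs))
                                 (interchange +-commutativeSemigroup (f x) (g x) _ _)

∑-comm : ∀ (f : A → B → ℕ) xs ys → ∑[ x ∈ xs ] ∑[ y ∈ ys ] f x y ≡ ∑[ y ∈ ys ] ∑[ x ∈ xs ] f x y
∑-comm f []       ys = sym (∑-zero ys)
∑-comm f (x ∷ xs) ys = trans (cong (∑ ys (f x) +_) (∑-comm f xs ys))
                             (sym (∑-distrib-+ (f x) _ ys))

∑-++ : ∀ (f : A → ℕ) xs ys → ∑ (xs ++ ys) f ≡ ∑ xs f + ∑ ys f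
∑-++ f xs ys = trans (cong sum (map-++ f xs ys)) (sum-++ (map f xs) _)

∑-map : ∀ (f : B → ℕ) (g : A → B) xs → ∑ (map g xs) f ≡ ∑ xs (f ∘ g)
∑-map f g []       = refl
∑-map f g (x ∷ xs) = cong (f (g x) +_) (∑-map f g xs)

∑-cartesianProductWith : ∀ (h : A → B → X) (f : X → ℕ) xs ys →
  ∑ (cartesianProductWith h xs ys) f ≡ ∑[ x ∈ xs ] ∑[ y ∈ ys ] f (h x y)
∑-cartesianProductWith h f []       ys = refl
∑-cartesianProductWith h f (x ∷ xs) ys =
  trans (∑-++ f (map (h x) ys) _)
        (cong₂ _+_ (∑-map f (h x) ys) (∑-cartesianProductWith h f xs ys))

∑-cartesianProduct-* : ∀ (f : A → ℕ) (g : B → ℕ) xs ys →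
  ∑[ p ∈ cartesianProduct xs ys ] f (proj₁ p) * g (proj₂ p) ≡ ∑ xs f * ∑ ys g
∑-cartesianProduct-* f g xs ys = begin
  ∑[ p ∈ cartesianProduct xs ys ] f (proj₁ p) * g (proj₂ p) ≡⟨ ∑-cartesianProductWith _,_ _ xs ys ⟩
  ∑[ x ∈ xs ] ∑[ y ∈ ys ] f x * g y                         ≡⟨ ∑-cong xs (λ x → *-distribˡ-∑ (f x) g ys) ⟨
  ∑[ x ∈ xs ] f x * ∑ ys g                                  ≡⟨ ∑-*ʳ f (∑ ys g) xs ⟨
  ∑ xs f * ∑ ys g                                           ∎
  where open ≡-Reasoning

length-filter : ∀ (p : A → Bool) xs → length (filter (T? ∘ p) xs) ≡ ∑[ x ∈ xs ] indicator (p x)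
length-filter p []       = refl
length-filter p (x ∷ xs) with p x
... | true  = cong suc (length-filter p xs)
... | false = length-filter p xs

∑-average : ∀ {f g : A → ℕ} {M} xs → 0 < length xs →
            ∑ xs g + length xs * M ≤ ∑ xs f → ∃ λ x → g x + M ≤ f x
∑-average {f = f} {g} {M} xs nonempty avg with any? (λ x → g x + M ≤? f x) xs
... | yes some = satisfied some
... | no  none = contradiction avg (<⇒≱ (begin-strict
  ∑ xs f                   <⟨ m<m+n (∑ xs f) nonempty ⟩
  ∑ xs f + length xs       ≡⟨ cong (∑ xs f +_) (sym (trans (∑-const xs 1) (*-identityʳ _))) ⟩
  ∑ xs f + (∑[ x ∈ xs ] 1) ≡⟨ sym (∑-distrib-+ f (λ _ → 1) xs) ⟩
  ∑[ x ∈ xs ] (f x + 1)    ≤⟨ ∑-mono-≤ (All.map f+1≤g+M (All.¬Any⇒All¬ xs none)) ⟩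
  ∑[ x ∈ xs ] (g x + M)    ≡⟨ ∑-distrib-+ g (λ _ → M) xs ⟩
  ∑ xs g + (∑[ x ∈ xs ] M) ≡⟨ cong (∑ xs g +_) (∑-const xs M) ⟩
  ∑ xs g + length xs * M   ∎))
  where
  open ≤-Reasoning
  f+1≤g+M : ∀ {x} → g x + M ≰ f x → f x + 1 ≤ g x + M
  f+1≤g+M {x} g+M≰f = subst (_≤ g x + M) (+-comm 1 (f x)) (≰⇒> g+M≰f)

length-cartesianProductWith : ∀ (h : A → B → X) xs ys →
  length (cartesianProductWith h xs ys) ≡ length xs * length ys
length-cartesianProductWith h []       ys = refl
length-cartesianProductWith h (x ∷ xs) ys =
  trans (length-++ (map (h x) ys)) (cong₂ _+_ (length-map (h x) ys) (length-cartesianProductWith h xs ys))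

vectors : List A → (m : ℕ) → List (Vec A m)
vectors xs zero    = [] ∷ []
vectors xs (suc m) = cartesianProductWith _∷_ xs (vectors xs m)

length-vectors : ∀ (xs : List A) m → length (vectors xs m) ≡ length xs ^ m
length-vectors xs zero    = refl
length-vectors xs (suc m) = trans (length-cartesianProductWith _∷_ xs (vectors xs m))
                                  (cong (length xs *_) (length-vectors xs m))

∈-vectors : ∀ {xs : List A} → (∀ x → x ∈ xs) → ∀ {m} (v : Vec A m) → v ∈ vectors xs m
∈-vectors complete []      = here refl
∈-vectors complete (x ∷ v) = ∈-cartesianProductWith⁺ _∷_ (complete x) (∈-vectors complete v)

vectors-unique : ∀ {xs : List A} → Unique xs → ∀ m → Unique (vectors xs m)
vectors-unique xs! zero    = [] ∷ []
vectors-unique xs! (suc m) = Unique.cartesianProductWith⁺ _∷_ ∷-injective xs! (vectors-unique xs! m)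

subsetsOfSize : ∀ n → ℕ → List (Subset n)
subsetsOfSize n       zero    = Subset.⊥ ∷ []
subsetsOfSize zero    (suc k) = []
subsetsOfSize (suc n) (suc k) = map (inside ∷_) (subsetsOfSize n k) ++ map (outside ∷_) (subsetsOfSize n (suc k))

length-subsetsOfSize : ∀ n k → length (subsetsOfSize n k) ≡ n C k
length-subsetsOfSize n       zero    = refl
length-subsetsOfSize zero    (suc k) = refl
length-subsetsOfSize (suc n) (suc k) = begin
  length (map (inside ∷_) (subsetsOfSize n k) ++ map (outside ∷_) (subsetsOfSize n (suc k)))
    ≡⟨ length-++ (map (inside ∷_) (subsetsOfSize n k)) ⟩
  length (map (inside ∷_) (subsetsOfSize n k)) + length (map (outside ∷_) (subsetsOfSize n (suc k)))
    ≡⟨ cong₂ _+_ (length-map _ (subsetsOfSize n k)) (length-map _ (subsetsOfSize n (suc k))) ⟩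
  length (subsetsOfSize n k) + length (subsetsOfSize n (suc k))
    ≡⟨ cong₂ _+_ (length-subsetsOfSize n k) (length-subsetsOfSize n (suc k)) ⟩
  n C k + n C suc k
    ≡⟨ nCk+nC[k+1]≡[n+1]C[k+1] n k ⟩
  suc n C suc k ∎
  where open ≡-Reasoning

subsetsOfSize-size : ∀ n k → All (λ e → ∣ e ∣ ≡ k) (subsetsOfSize n k)
subsetsOfSize-size n       zero    = ∣⊥∣≡0 n ∷ []
subsetsOfSize-size zero    (suc k) = []
subsetsOfSize-size (suc n) (suc k) = All.++⁺ (All.map⁺ (All.map (cong suc) (subsetsOfSize-size n k)))
                                             (All.map⁺ (subsetsOfSize-size n (suc k)))

subsetsOfSize-unique : ∀ n k → Unique (subsetsOfSize n k)
subsetsOfSize-unique n       zero    = [] ∷ []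
subsetsOfSize-unique zero    (suc k) = []
subsetsOfSize-unique (suc n) (suc k) =
  Unique.++⁺ (Unique.map⁺ ∷-injectiveʳ (subsetsOfSize-unique n k))
             (Unique.map⁺ ∷-injectiveʳ (subsetsOfSize-unique n (suc k)))
             λ (∈ins , ∈outs) → ins≢outs (∈-map⁻ (inside ∷_) ∈ins) (∈-map⁻ (outside ∷_) ∈outs)
  where
  ins≢outs : ∀ {e : Subset (suc n)} {xs ys} →
             ∃ (λ x → x ∈ xs × e ≡ inside ∷ x) → ∃ (λ y → y ∈ ys × e ≡ outside ∷ y) → ⊥
  ins≢outs (_ , _ , refl) (_ , _ , ())

module _ (_≟_ : DecidableEquality A) where

  delete : A → List A → List A
  delete x = filter (λ y → ¬? (y ≟ x))

  length-delete : ∀ x {ys} → Unique ys → length ys ≤ suc (length (delete x ys))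
  length-delete x {[]}     []           = z≤n
  length-delete x {y ∷ ys} (y∉ys ∷ ys!) with y ≟ x
  ... | yes refl = s≤s (≤-reflexive (cong length (sym (filter-all (λ y → ¬? (y ≟ x)) (All.map (_∘ sym) y∉ys)))))
  ... | no _     = s≤s (length-delete x ys!)

  deleteAll : List A → List A → List A
  deleteAll xs ys = foldr delete ys xs

  deleteAll-unique : ∀ xs {ys} → Unique ys → Unique (deleteAll xs ys)
  deleteAll-unique []       ys! = ys!
  deleteAll-unique (x ∷ xs) ys! = Unique.filter⁺ _ (deleteAll-unique xs ys!)

  All-deleteAll : ∀ {P : A → Set} xs {ys} → All P ys → All P (deleteAll xs ys)
  All-deleteAll []       pys = pys
  All-deleteAll (x ∷ xs) pys = All.filter⁺ _ (All-deleteAll xs pys)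

  ∈-deleteAll⁻ : ∀ xs {ys y} → y ∈ deleteAll xs ys → y ∈ ys × y ∉ xs
  ∈-deleteAll⁻ []       y∈ = y∈ , λ ()
  ∈-deleteAll⁻ (x ∷ xs) y∈ with ∈-filter⁻ (λ y → ¬? (y ≟ x)) y∈
  ... | y∈′ , y≢x with ∈-deleteAll⁻ xs y∈′
  ...   | y∈ys , y∉xs = y∈ys , λ { (here y≡x) → y≢x y≡x ; (there y∈xs) → y∉xs y∈xs }

  length-deleteAll : ∀ xs {ys} → Unique ys → length ys ≤ length xs + length (deleteAll xs ys)
  length-deleteAll []       ys! = ≤-refl
  length-deleteAll (x ∷ xs) ys! = ≤-trans (length-deleteAll xs ys!)
    (≤-trans (+-monoʳ-≤ (length xs) (length-delete x (deleteAll-unique xs ys!)))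
             (≤-reflexive (+-suc (length xs) _)))

^-distrib-* : ∀ x y n → (x * y) ^ n ≡ x ^ n * y ^ n
^-distrib-* x y zero    = refl
^-distrib-* x y (suc n) = trans (cong (x * y *_) (^-distrib-* x y n)) (interchange *-commutativeSemigroup x y (x ^ n) (y ^ n))

[k+1]*[n+1]C[k+1]≡[n+1]*nCk : ∀ n k → suc k * (suc n C suc k) ≡ suc n * (n C k)
[k+1]*[n+1]C[k+1]≡[n+1]*nCk zero    zero    = refl
[k+1]*[n+1]C[k+1]≡[n+1]*nCk zero    (suc k) = *-zeroʳ (suc (suc k))
[k+1]*[n+1]C[k+1]≡[n+1]*nCk (suc n) zero    =
  trans (+-identityʳ _) (trans (nC1≡n (suc (suc n))) (sym (*-identityʳ (suc (suc n)))))
[k+1]*[n+1]C[k+1]≡[n+1]*nCk (suc n) (suc k) = begin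
  suc (suc k) * (suc (suc n) C suc (suc k))
    ≡⟨ cong (suc (suc k) *_) (nCk+nC[k+1]≡[n+1]C[k+1] (suc n) (suc k)) ⟨
  suc (suc k) * (suc n C suc k + suc n C suc (suc k))
    ≡⟨ split k (suc n C suc k) (suc n C suc (suc k)) ⟩
  suc k * (suc n C suc k) + suc n C suc k + suc (suc k) * (suc n C suc (suc k))
    ≡⟨ cong₂ (λ x y → x + suc n C suc k + y) ([k+1]*[n+1]C[k+1]≡[n+1]*nCk n k)
                                              ([k+1]*[n+1]C[k+1]≡[n+1]*nCk n (suc k)) ⟩
  suc n * (n C k) + suc n C suc k + suc n * (n C suc k)
    ≡⟨ join (suc n) (n C k) (n C suc k) (suc n C suc k) ⟩
  suc n * (n C k + n C suc k) + suc n C suc k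
    ≡⟨ cong (λ x → suc n * x + suc n C suc k) (nCk+nC[k+1]≡[n+1]C[k+1] n k) ⟩
  suc n * (suc n C suc k) + suc n C suc k
    ≡⟨ +-comm (suc n * (suc n C suc k)) _ ⟩
  suc (suc n) * (suc n C suc k) ∎
  where
  open ≡-Reasoning
  split : ∀ k x y → suc (suc k) * (x + y) ≡ suc k * x + x + suc (suc k) * y
  split = solve-∀
  join : ∀ m x y z → m * x + z + m * y ≡ m * (x + y) + z
  join = solve-∀

[n∸k]^k≤k!*nCk : ∀ k n → (n ∸ k) ^ k ≤ k ! * (n C k)
[n∸k]^k≤k!*nCk zero    n       = ≤-refl
[n∸k]^k≤k!*nCk (suc k) zero    = z≤n
[n∸k]^k≤k!*nCk (suc k) (suc n) = begin
  (n ∸ k) * (n ∸ k) ^ k           ≤⟨ *-mono-≤ (≤-trans (m∸n≤m n k) (n≤1+n n)) ([n∸k]^k≤k!*nCk k n) ⟩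
  suc n * (k ! * (n C k))          ≡⟨ x∙yz≈y∙xz *-commutativeSemigroup (suc n) (k !) (n C k) ⟩
  k ! * (suc n * (n C k))          ≡⟨ cong (k ! *_) ([k+1]*[n+1]C[k+1]≡[n+1]*nCk n k) ⟨
  k ! * (suc k * (suc n C suc k))  ≡⟨ x∙yz≈yx∙z *-commutativeSemigroup (k !) (suc k) (suc n C suc k) ⟩
  suc k * k ! * (suc n C suc k)    ∎
  where
  open ≤-Reasoning

n!≤n^n : ∀ n → n ! ≤ n ^ n
n!≤n^n zero    = ≤-refl
n!≤n^n (suc n) = *-monoʳ-≤ (suc n) (≤-trans (n!≤n^n n) (^-monoˡ-≤ n (n≤1+n n)))

n^k≤[2k]^k*nCk : ∀ k n → 2 * k ≤ n → n ^ k ≤ (2 * k) ^ k * (n C k)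
n^k≤[2k]^k*nCk k n 2k≤n = begin
  n ^ k                    ≤⟨ ^-monoˡ-≤ k n≤2[n∸k] ⟩
  (2 * (n ∸ k)) ^ k        ≡⟨ ^-distrib-* 2 (n ∸ k) k ⟩
  2 ^ k * (n ∸ k) ^ k      ≤⟨ *-monoʳ-≤ (2 ^ k) ([n∸k]^k≤k!*nCk k n) ⟩
  2 ^ k * (k ! * (n C k))  ≤⟨ *-monoʳ-≤ (2 ^ k) (*-monoˡ-≤ (n C k) (n!≤n^n k)) ⟩
  2 ^ k * (k ^ k * (n C k)) ≡⟨ *-assoc (2 ^ k) (k ^ k) (n C k) ⟨
  2 ^ k * k ^ k * (n C k)  ≡⟨ cong (_* (n C k)) (^-distrib-* 2 k k) ⟨
  (2 * k) ^ k * (n C k)    ∎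
  where
  open ≤-Reasoning
  k+k≤n : k + k ≤ n
  k+k≤n = subst (_≤ n) (cong (k +_) (+-identityʳ k)) 2k≤n
  n≤2[n∸k] : n ≤ 2 * (n ∸ k)
  n≤2[n∸k] = begin
    n                 ≡⟨ m+[n∸m]≡n (m+n≤o⇒n≤o k k+k≤n) ⟨
    k + (n ∸ k)       ≤⟨ +-monoˡ-≤ (n ∸ k) (m+n≤o⇒m≤o∸n k k+k≤n) ⟩
    (n ∸ k) + (n ∸ k) ≡⟨ cong ((n ∸ k) +_) (+-identityʳ (n ∸ k)) ⟨
    2 * (n ∸ k)       ∎

root : ∀ D .{{_ : NonZero D}} n → ∃ λ r → r ^ D ≤ n × n < suc r ^ D
root D@(suc _) zero = 0 , z≤n , subst (0 <_) (sym (^-zeroˡ D)) (s≤s z≤n)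
root D (suc n) with root D n
... | r , r^D≤n , n<[1+r]^D with suc r ^ D ≤? suc n
...   | yes [1+r]^D≤1+n = suc r , [1+r]^D≤1+n , (begin-strict
          suc n         ≡⟨ ≤-antisym n<[1+r]^D [1+r]^D≤1+n ⟩
          suc r ^ D     <⟨ ^-monoˡ-< D (n<1+n (suc r)) ⟩
          suc (suc r) ^ D ∎)
  where open ≤-Reasoning
...   | no [1+r]^D≰1+n = r , m≤n⇒m≤1+n r^D≤n , ≰⇒> [1+r]^D≰1+n

-- Uniform random colourings of the subsets of Fin n

section : ∀ {n} → Bool → List (Subset (suc n)) → List (Subset n)
section b []             = []
section b ((x ∷ e) ∷ es) with x Bool.≟ b
... | yes _ = e ∷ section b es
... | no _  = section b es

length-section : ∀ {n} (es : List (Subset (suc n))) →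
                 length es ≡ length (section outside es) + length (section inside es)
length-section []                   = refl
length-section ((outside ∷ e) ∷ es) = cong suc (length-section es)
length-section ((inside ∷ e) ∷ es)  = trans (cong suc (length-section es)) (sym (+-suc _ _))

∈-section⁻ : ∀ {n} b (es : List (Subset (suc n))) {e} → e ∈ section b es → (b ∷ e) ∈ es
∈-section⁻ b ((x ∷ e) ∷ es) e∈ with x Bool.≟ b | e∈
... | yes refl | here refl = here refl
... | yes refl | there e∈′ = there (∈-section⁻ b es e∈′)
... | no _     | e∈′       = there (∈-section⁻ b es e∈′)

section-unique : ∀ {n} b {es : List (Subset (suc n))} → Unique es → Unique (section b es)
section-unique b {[]}           []             = []
section-unique b {(x ∷ e) ∷ es} (xe∉es ∷ es!) with x Bool.≟ b
... | yes refl = All.tabulate (λ e′∈ e≡e′ → All.lookup xe∉es (∈-section⁻ b es e′∈) (cong (x ∷_) e≡e′))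
             ∷ section-unique b es!
... | no _     = section-unique b es!

∑-allFin-isZero : ∀ m .{{_ : NonZero m}} → ∑[ c ∈ allFin m ] indicator (toℕ c ≡ᵇ 0) ≡ 1
∑-allFin-isZero (suc m) = cong suc (begin
  sum (map isZero (tabulate {n = m} suc)) ≡⟨ cong sum (map-tabulate {n = m} suc isZero) ⟩
  sum (tabulate {n = m} (λ _ → 0))        ≡⟨ cong sum (map-tabulate {n = m} (λ i → i) (λ _ → 0)) ⟨
  ∑[ c ∈ allFin m ] 0                      ≡⟨ ∑-zero (allFin m) ⟩
  0                                        ∎)
  where
  open ≡-Reasoning
  isZero : Fin (suc m) → ℕ
  isZero c = indicator (toℕ c ≡ᵇ 0)

-- Colouring n colours every subset of Fin n with one of q colours, stored as a complete binary tree
-- indexed by the characteristic vector.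
module Colourings (q : ℕ) .{{_ : NonZero q}} where

  Colouring : ℕ → Set
  Colouring zero    = Fin q
  Colouring (suc n) = Colouring n × Colouring n

  colour : ∀ {n} → Colouring n → Subset n → Fin q
  colour {zero}  c         []            = c
  colour {suc n} (s₀ , s₁) (outside ∷ e) = colour s₀ e
  colour {suc n} (s₀ , s₁) (inside ∷ e)  = colour s₁ e

  colourings : ∀ n → List (Colouring n)
  colourings zero    = allFin q
  colourings (suc n) = cartesianProduct (colourings n) (colourings n)

  colourings-nonempty : ∀ n → 0 < length (colourings n)
  colourings-nonempty zero    = subst (0 <_) (sym (length-tabulate {n = q} (λ i → i))) (>-nonZero⁻¹ q)
  colourings-nonempty (suc n) = subst (0 <_) (sym (length-cartesianProductWith _,_ (colourings n) (colourings n)))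
                                      (*-mono-< (colourings-nonempty n) (colourings-nonempty n))

  kept : ∀ {n} → Colouring n → Subset n → Bool
  kept s e = toℕ (colour s e) ≡ᵇ 0

  all-kept-section : ∀ {n} (s₀ s₁ : Colouring n) es →
    all (kept (s₀ , s₁)) es ≡ all (kept s₀) (section outside es) ∧ all (kept s₁) (section inside es)
  all-kept-section s₀ s₁ []                   = refl
  all-kept-section s₀ s₁ ((outside ∷ e) ∷ es) =
    trans (cong (kept s₀ e ∧_) (all-kept-section s₀ s₁ es)) (sym (∧-assoc (kept s₀ e) _ _))
  all-kept-section s₀ s₁ ((inside ∷ e) ∷ es)  =
    trans (cong (kept s₁ e ∧_) (all-kept-section s₀ s₁ es))
          (x∙yz≈y∙xz (CommutativeMonoid.commutativeSemigroup ∧-commutativeMonoid)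
                     (kept s₁ e) (all (kept s₀) (section outside es)) _)

  -- Counting form of: the events "e is kept" for distinct e ∈ es are independent, each of probability 1/q.
  independence : ∀ n (es : List (Subset n)) → Unique es →
    q ^ length es * (∑[ s ∈ colourings n ] indicator (all (kept s) es)) ≡ length (colourings n)
  independence zero []              _               =
    trans (+-identityʳ _) (trans (∑-const (allFin q) 1) (*-identityʳ (length (allFin q))))
  independence zero ([] ∷ [])       _               = begin
    q ^ 1 * (∑[ c ∈ allFin q ] indicator (kept c [] ∧ true))
      ≡⟨ cong (q ^ 1 *_) (∑-cong (allFin q) (λ c → cong indicator (∧-identityʳ (kept c [])))) ⟩
    q ^ 1 * (∑[ c ∈ allFin q ] indicator (kept c []))
      ≡⟨ cong (q ^ 1 *_) (∑-allFin-isZero q) ⟩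
    q * 1 * 1
      ≡⟨ trans (*-identityʳ _) (*-identityʳ q) ⟩
    q
      ≡⟨ length-tabulate (λ c → c) ⟨
    length (allFin q) ∎
    where open ≡-Reasoning
  independence zero ([] ∷ [] ∷ _) ((≢[] ∷ _) ∷ _) = ⊥-elim (≢[] refl)
  independence (suc n) es es! = begin
    q ^ length es * (∑[ s ∈ cartesianProduct Ω Ω ] indicator (all (kept s) es))
      ≡⟨ cong₂ (λ l σ → q ^ l * σ) (length-section es)
               (∑-cong (cartesianProduct Ω Ω) λ (s₀ , s₁) →
                  trans (cong indicator (all-kept-section s₀ s₁ es)) (indicator-∧ (all (kept s₀) es₀) _)) ⟩
    q ^ (l₀ + l₁) * (∑[ s ∈ cartesianProduct Ω Ω ] K₀ (proj₁ s) * K₁ (proj₂ s))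
      ≡⟨ cong (q ^ (l₀ + l₁) *_) (∑-cartesianProduct-* K₀ K₁ Ω Ω) ⟩
    q ^ (l₀ + l₁) * (∑ Ω K₀ * ∑ Ω K₁)
      ≡⟨ cong (_* (∑ Ω K₀ * ∑ Ω K₁)) (^-distribˡ-+-* q l₀ l₁) ⟩
    q ^ l₀ * q ^ l₁ * (∑ Ω K₀ * ∑ Ω K₁)
      ≡⟨ interchange *-commutativeSemigroup (q ^ l₀) (q ^ l₁) (∑ Ω K₀) (∑ Ω K₁) ⟩
    q ^ l₀ * ∑ Ω K₀ * (q ^ l₁ * ∑ Ω K₁)
      ≡⟨ cong₂ _*_ (independence n es₀ (section-unique outside es!))
                   (independence n es₁ (section-unique inside es!)) ⟩
    length Ω * length Ω
      ≡⟨ length-cartesianProductWith _,_ Ω Ω ⟨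
    length (cartesianProduct Ω Ω) ∎
    where
    open ≡-Reasoning
    Ω : List (Colouring n)
    Ω = colourings n
    es₀ es₁ : List (Subset n)
    es₀ = section outside es
    es₁ = section inside es
    l₀ l₁ : ℕ
    l₀ = length es₀
    l₁ = length es₁
    K₀ K₁ : Colouring n → ℕ
    K₀ s = indicator (all (kept s) es₀)
    K₁ s = indicator (all (kept s) es₁)

  independence-singleton : ∀ n (e : Subset n) →
    q * (∑[ s ∈ colourings n ] indicator (kept s e)) ≡ length (colourings n)
  independence-singleton n e = begin
    q * (∑[ s ∈ colourings n ] indicator (kept s e))
      ≡⟨ cong₂ _*_ (*-identityʳ q) (∑-cong (colourings n) λ s → cong indicator (∧-identityʳ (kept s e))) ⟨
    q ^ 1 * (∑[ s ∈ colourings n ] indicator (all (kept s) (e ∷ [])))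
      ≡⟨ independence n (e ∷ []) ([] ∷ []) ⟩
    length (colourings n) ∎
    where open ≡-Reasoning

-- Placements of K and the deletion method

∈-image : ∀ {m n} (h : Fin m → Fin n) i → h i Subset.∈ image h
∈-image h zero    = x∈p∪q⁺ (inj₁ (x∈⁅x⁆ (h zero)))
∈-image h (suc i) = x∈p∪q⁺ (inj₂ (∈-image (h ∘ suc) i))

∈-image⁻ : ∀ {m n} (h : Fin m → Fin n) {x} → x Subset.∈ image h → ∃ λ i → h i ≡ x
∈-image⁻ {zero}  h x∈ = ⊥-elim (∉⊥ x∈)
∈-image⁻ {suc m} h x∈ with x∈p∪q⁻ ⁅ h zero ⁆ (image (h ∘ suc)) x∈
... | inj₁ x∈h0 = zero , sym (x∈⁅y⁆⇒x≡y _ x∈h0)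
... | inj₂ x∈hs = let i , hi≡x = ∈-image⁻ (h ∘ suc) x∈hs in suc i , hi≡x

image-cong : ∀ {m n} {h h′ : Fin m → Fin n} → (∀ i → h i ≡ h′ i) → image h ≡ image h′
image-cong {zero}  h≗h′ = refl
image-cong {suc m} h≗h′ = cong₂ _∪_ (cong ⁅_⁆ (h≗h′ zero)) (image-cong (h≗h′ ∘ suc))

image-transversal-injective : ∀ {k d n} {F : Fin k → Fin d → Fin n} → Injective _≡_ _≡_ (uncurry F) →
  ∀ {g g′ : Fin k → Fin d} → image (λ i → F i (g i)) ≡ image (λ i → F i (g′ i)) → ∀ i → g i ≡ g′ i
image-transversal-injective {F = F} F-inj {g} {g′} eq i
  with ∈-image⁻ (λ j → F j (g′ j)) (subst (F i (g i) Subset.∈_) eq (∈-image (λ j → F j (g j)) i))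
... | j , F[j,g′j]≡F[i,gi] with F-inj {j , g′ j} {i , g i} F[j,g′j]≡F[i,gi]
...   | [j,g′j]≡[i,gi] with ,-injectiveˡ [j,g′j]≡[i,gi]
...     | refl = sym (,-injectiveʳ [j,g′j]≡[i,gi])

_≟ˢ_ : ∀ {n} → DecidableEquality (Subset n)
_≟ˢ_ = ≡-dec Bool._≟_

placements : ∀ k d n → List (Fin k → Fin d → Fin n)
placements k d n = map (λ F i j → lookup (lookup F i) j) (vectors (vectors (allFin n) d) k)

length-placements : ∀ k d n → length (placements k d n) ≡ (n ^ d) ^ k
length-placements k d n = begin
  length (placements k d n)              ≡⟨ length-map _ (vectors (vectors (allFin n) d) k) ⟩
  length (vectors (vectors (allFin n) d) k) ≡⟨ length-vectors (vectors (allFin n) d) k ⟩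
  length (vectors (allFin n) d) ^ k      ≡⟨ cong (_^ k) (length-vectors (allFin n) d) ⟩
  (length (allFin n) ^ d) ^ k            ≡⟨ cong (λ l → (l ^ d) ^ k) (length-tabulate {n = n} (λ i → i)) ⟩
  (n ^ d) ^ k                            ∎
  where open ≡-Reasoning

∈-placements : ∀ {k d n} (f : Fin k → Fin d → Fin n) →
               ∃ λ F → F ∈ placements k d n × (∀ i j → F i j ≡ f i j)
∈-placements {k} {d} {n} f =
  _ , ∈-map⁺ _ (∈-vectors (∈-vectors ∈-allFin) (Vec.tabulate (Vec.tabulate ∘ f))) , F≗f
  where
  F≗f : ∀ i j → lookup (lookup (Vec.tabulate (Vec.tabulate ∘ f)) i) j ≡ f i j
  F≗f i j = trans (cong (λ v → lookup v j) (lookup∘tabulate (Vec.tabulate ∘ f) i)) (lookup∘tabulate (f i) j)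

copyEdges : ∀ {k d n} → (Fin k → Fin d → Fin n) → List (Subset n)
copyEdges {k} {d} F = map (λ g → image (λ i → F i (lookup g i))) (vectors (allFin d) k)

length-copyEdges : ∀ {k d n} (F : Fin k → Fin d → Fin n) → length (copyEdges F) ≡ d ^ k
length-copyEdges {k} {d} F = trans (length-map _ (vectors (allFin d) k))
  (trans (length-vectors (allFin d) k) (cong (_^ k) (length-tabulate {n = d} (λ i → i))))

copyEdges-unique : ∀ {k d n} {F : Fin k → Fin d → Fin n} → Injective _≡_ _≡_ (uncurry F) → Unique (copyEdges F)
copyEdges-unique {k} {d} {F = F} F-inj = Unique.map⁺ vector-ext (vectors-unique (Unique.allFin⁺ d) k)
  where
  vector-ext : ∀ {g g′ : Vec (Fin d) k} →
               image (λ i → F i (lookup g i)) ≡ image (λ i → F i (lookup g′ i)) → g ≡ g′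
  vector-ext {g} {g′} eq = begin
    g                        ≡⟨ tabulate∘lookup g ⟨
    Vec.tabulate (lookup g)  ≡⟨ tabulate-cong (image-transversal-injective F-inj eq) ⟩
    Vec.tabulate (lookup g′) ≡⟨ tabulate∘lookup g′ ⟩
    g′                       ∎
    where open ≡-Reasoning

module Deletion (q : ℕ) .{{_ : NonZero q}} (n k d : ℕ) (j₀ : Fin d) where

  open Colourings q
  open import Data.List.Relation.Unary.Unique.DecPropositional (_≟ˢ_ {n}) using (unique?)

  Ω : List (Colouring n)
  Ω = colourings n

  randomEdges : Colouring n → List (Subset n)
  randomEdges s = filter (T? ∘ kept s) (subsetsOfSize n k)

  ∑-length-randomEdges : q * (∑[ s ∈ Ω ] length (randomEdges s)) ≡ (n C k) * length Ω
  ∑-length-randomEdges = begin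
    q * (∑[ s ∈ Ω ] length (randomEdges s))          ≡⟨ cong (q *_) (∑-cong Ω λ s → length-filter (kept s) S) ⟩
    q * (∑[ s ∈ Ω ] ∑[ e ∈ S ] indicator (kept s e)) ≡⟨ cong (q *_) (∑-comm (λ s e → indicator (kept s e)) Ω S) ⟩
    q * (∑[ e ∈ S ] ∑[ s ∈ Ω ] indicator (kept s e)) ≡⟨ *-distribˡ-∑ q _ S ⟩
    ∑[ e ∈ S ] q * (∑[ s ∈ Ω ] indicator (kept s e)) ≡⟨ ∑-cong S (independence-singleton n) ⟩
    ∑[ e ∈ S ] length Ω                              ≡⟨ ∑-const S (length Ω) ⟩
    length S * length Ω                              ≡⟨ cong (_* length Ω) (length-subsetsOfSize n k) ⟩
    (n C k) * length Ω                               ∎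
    where
    open ≡-Reasoning
    S : List (Subset n)
    S = subsetsOfSize n k

  -- Distinctness of the d^k edges, rather than injectivity of F, is what `independence` needs.
  bad : Colouring n → (Fin k → Fin d → Fin n) → Bool
  bad s F = does (unique? (copyEdges F)) ∧ all (kept s) (copyEdges F)

  numBad : Colouring n → ℕ
  numBad s = ∑[ F ∈ placements k d n ] indicator (bad s F)

  ∑-indicator-bad : ∀ F → q ^ d ^ k * (∑[ s ∈ Ω ] indicator (bad s F)) ≤ length Ω
  ∑-indicator-bad F with unique? (copyEdges F)
  ... | yes es! = ≤-reflexive (trans (cong (λ l → q ^ l * (∑[ s ∈ Ω ] indicator (all (kept s) (copyEdges F))))
                                           (sym (length-copyEdges F)))
                                     (independence n (copyEdges F) es!))
  ... | no _    = ≤-trans (≤-reflexive (trans (cong (q ^ d ^ k *_) (∑-zero Ω)) (*-zeroʳ (q ^ d ^ k)))) z≤n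

  ∑-numBad : q ^ d ^ k * (∑[ s ∈ Ω ] numBad s) ≤ (n ^ d) ^ k * length Ω
  ∑-numBad = begin
    q ^ d ^ k * (∑[ s ∈ Ω ] numBad s)                      ≡⟨ cong (q ^ d ^ k *_) (∑-comm bad′ Ω P) ⟩
    q ^ d ^ k * (∑[ F ∈ P ] ∑[ s ∈ Ω ] indicator (bad s F)) ≡⟨ *-distribˡ-∑ (q ^ d ^ k) _ P ⟩
    ∑[ F ∈ P ] q ^ d ^ k * (∑[ s ∈ Ω ] indicator (bad s F)) ≤⟨ ∑-mono-≤ (All.universal ∑-indicator-bad P) ⟩
    ∑[ F ∈ P ] length Ω                                    ≡⟨ ∑-const P (length Ω) ⟩
    length P * length Ω                                    ≡⟨ cong (_* length Ω) (length-placements k d n) ⟩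
    (n ^ d) ^ k * length Ω                                 ∎
    where
    open ≤-Reasoning
    P : List (Fin k → Fin d → Fin n)
    P = placements k d n
    bad′ : Colouring n → (Fin k → Fin d → Fin n) → ℕ
    bad′ s F = indicator (bad s F)

  designatedEdge : (Fin k → Fin d → Fin n) → Subset n
  designatedEdge F = image (λ i → F i j₀)

  deleted : Colouring n → List (Subset n)
  deleted s = map designatedEdge (filter (T? ∘ bad s) (placements k d n))

  randomEdges-unique : ∀ s → Unique (randomEdges s)
  randomEdges-unique s = Unique.filter⁺ (T? ∘ kept s) (subsetsOfSize-unique n k)

  pruned : Colouring n → UniformHypergraph k n
  pruned s = record
    { edges   = deleteAll _≟ˢ_ (deleted s) (randomEdges s)
    ; unique  = deleteAll-unique _≟ˢ_ (deleted s) (randomEdges-unique s)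
    ; uniform = All-deleteAll _≟ˢ_ (deleted s) (All.filter⁺ (T? ∘ kept s) (subsetsOfSize-size n k))
    }

  length-randomEdges≤ : ∀ s → length (randomEdges s) ≤ numBad s + numEdges (pruned s)
  length-randomEdges≤ s = subst (λ b → length (randomEdges s) ≤ b + numEdges (pruned s))
    (trans (length-map designatedEdge (filter (T? ∘ bad s) (placements k d n))) (length-filter (bad s) (placements k d n)))
    (length-deleteAll _≟ˢ_ (deleted s) (randomEdges-unique s))

  pruned-KFree : ∀ s → KFree d (pruned s)
  pruned-KFree s (f , f-inj , f-edges) with ∈-placements f
  ... | F , F∈P , F≗f = proj₂ (∈-deleteAll⁻ _≟ˢ_ (deleted s) (f-edges (λ _ → j₀))) designated∈deleted
    where

    F-inj : Injective _≡_ _≡_ (uncurry F)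
    F-inj {i , j} {i′ , j′} eq = f-inj (trans (sym (F≗f i j)) (trans eq (F≗f i′ j′)))

    kept-copyEdges : All.All (T ∘ kept s) (copyEdges F)
    kept-copyEdges = All.map⁺ (All.universal kept-edge (vectors (allFin d) k))
      where
      kept-edge : ∀ g → T (kept s (image (λ i → F i (lookup g i))))
      kept-edge g = subst (T ∘ kept s) (image-cong (λ i → sym (F≗f i (lookup g i))))
        (proj₂ (∈-filter⁻ (T? ∘ kept s) {xs = subsetsOfSize n k}
                          (proj₁ (∈-deleteAll⁻ _≟ˢ_ (deleted s) (f-edges (lookup g))))))

    F-bad : T (bad s F)
    F-bad with unique? (copyEdges F)
    ... | yes _  = All.all⁻ (kept s) kept-copyEdges
    ... | no ¬u! = ¬u! (copyEdges-unique F-inj)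

    designated∈deleted : designatedEdge f ∈ deleted s
    designated∈deleted = subst (_∈ deleted s) (image-cong (λ i → F≗f i j₀))
      (∈-map⁺ designatedEdge (∈-filter⁺ (T? ∘ bad s) F∈P F-bad))

  -- Integer form of: on average at most b placements are bad and at least b + M edges are kept.
  ∑-numBad+M≤∑-edges : ∀ b M → (n ^ d) ^ k ≤ q ^ d ^ k * b → q * b + q * M ≤ n C k →
                       ∑ Ω numBad + length Ω * M ≤ ∑ Ω (length ∘ randomEdges)
  ∑-numBad+M≤∑-edges b M copies≤ edges≥ = *-cancelˡ-≤ q (begin
    q * (∑ Ω numBad + length Ω * M)   ≤⟨ *-monoʳ-≤ q (+-monoˡ-≤ (length Ω * M) ∑numBad≤) ⟩
    q * (b * length Ω + length Ω * M) ≡⟨ rearrange q b M (length Ω) ⟩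
    (q * b + q * M) * length Ω        ≤⟨ *-monoˡ-≤ (length Ω) edges≥ ⟩
    (n C k) * length Ω                ≡⟨ ∑-length-randomEdges ⟨
    q * ∑ Ω (length ∘ randomEdges)    ∎)
    where
    open ≤-Reasoning
    instance _ = m^n≢0 q (d ^ k)
    rearrange : ∀ q b M w → q * (b * w + w * M) ≡ (q * b + q * M) * w
    rearrange = solve-∀
    ∑numBad≤ : ∑ Ω numBad ≤ b * length Ω
    ∑numBad≤ = *-cancelˡ-≤ (q ^ d ^ k) (begin
      q ^ d ^ k * ∑ Ω numBad     ≤⟨ ∑-numBad ⟩
      (n ^ d) ^ k * length Ω     ≤⟨ *-monoˡ-≤ (length Ω) copies≤ ⟩
      q ^ d ^ k * b * length Ω   ≡⟨ *-assoc (q ^ d ^ k) b (length Ω) ⟩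
      q ^ d ^ k * (b * length Ω) ∎)

  deletion : ∀ b M → (n ^ d) ^ k ≤ q ^ d ^ k * b → q * b + q * M ≤ n C k → ExAtLeast n k d M
  deletion b M copies≤ edges≥ with ∑-average Ω (colourings-nonempty n) (∑-numBad+M≤∑-edges b M copies≤ edges≥)
  ... | s , numBad+M≤edges =
    pruned s , pruned-KFree s , +-cancelˡ-≤ (numBad s) _ _ (≤-trans numBad+M≤edges (length-randomEdges≤ s))

expectedCopiesBound : ℕ → ℕ → ℕ
expectedCopiesBound k d = 2 ^ (k * d ^ k)

threshold : ℕ → ℕ → ℕ
threshold k d = (4 * k * expectedCopiesBound k d) * (4 * k * expectedCopiesBound k d)

0<threshold : ∀ k₁ d → 0 < threshold (suc k₁) d
0<threshold k₁ d = *-mono-< 0<C₀ 0<C₀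
  where
  0<C₀ : 0 < 4 * suc k₁ * expectedCopiesBound (suc k₁) d
  0<C₀ = *-mono-< (s≤s (z≤n {k₁ + 3 * suc k₁})) (m^n>0 2 (suc k₁ * d ^ suc k₁))

-- With D = d^{k-1}, r^D ≤ n < (r+1)^D, q = r^k colours and t = ⌊n/(4kr)⌋, we get n^{dk} ≤ 2^{k d^k} q^{d^k},
-- while q 2^{k d^k} and q t^k = (rt)^k are both at most C(n,k)/2 because C₀ r ≤ n, which the threshold
-- C₀² ≤ n forces through r² ≤ r^D ≤ n.
module Choice (k₁ d n r : ℕ) .{{_ : NonZero r}} (1≤k₁ : 1 ≤ k₁) (2≤d : 2 ≤ d)
              (threshold≤n : threshold (suc k₁) d ≤ n)
              (r^D≤n : r ^ d ^ k₁ ≤ n) (n<[1+r]^D : n < suc r ^ d ^ k₁) where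

  open ≤-Reasoning

  k D b C₀ : ℕ
  k = suc k₁
  D = d ^ k₁
  b = expectedCopiesBound k d
  C₀ = 4 * k * b

  instance
    _ = m^n≢0 2 (k * d ^ k)
    _ = m*n≢0 (4 * k) r

  2≤D : 2 ≤ D
  2≤D = ≤-trans 2≤d (≤-trans (≤-reflexive (sym (*-identityʳ d))) (^-monoʳ-≤ d 1≤k₁))
    where instance _ = >-nonZero (≤-trans (s≤s z≤n) 2≤d)

  C₀*r≤n : C₀ * r ≤ n
  C₀*r≤n with C₀ ≤? r
  ... | yes C₀≤r = begin
    C₀ * r    ≤⟨ *-monoˡ-≤ r C₀≤r ⟩
    r * r     ≡⟨ cong (r *_) (*-identityʳ r) ⟨
    r ^ 2     ≤⟨ ^-monoʳ-≤ r 2≤D ⟩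
    r ^ D     ≤⟨ r^D≤n ⟩
    n         ∎
  ... | no C₀≰r = ≤-trans (*-monoʳ-≤ C₀ (<⇒≤ (≰⇒> C₀≰r))) threshold≤n

  4kr≤n : 4 * k * r ≤ n
  4kr≤n = ≤-trans (*-monoˡ-≤ r (m≤m*n (4 * k) b)) C₀*r≤n

  t : ℕ
  t = n / (4 * k * r)

  t*4kr≤n : t * (4 * k * r) ≤ n
  t*4kr≤n = m/n*n≤m n (4 * k * r)

  n≤8kt*r : n ≤ 8 * k * t * r
  n≤8kt*r = begin
    n                        ≡⟨ m≡m%n+[m/n]*n n (4 * k * r) ⟩
    n % (4 * k * r) + t * (4 * k * r) ≤⟨ +-monoˡ-≤ _ (<⇒≤ (m%n<n n (4 * k * r))) ⟩
    4 * k * r + t * (4 * k * r) ≤⟨ +-monoˡ-≤ (t * (4 * k * r)) (m≤n*m (4 * k * r) t) ⟩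
    t * (4 * k * r) + t * (4 * k * r) ≡⟨ double t k r ⟩
    8 * k * t * r            ∎
    where
    instance _ = >-nonZero (m≥n⇒m/n>0 4kr≤n)
    double : ∀ t k r → t * (4 * k * r) + t * (4 * k * r) ≡ 8 * k * t * r
    double = solve-∀

  copies≤ : (n ^ d) ^ k ≤ (r ^ k) ^ d ^ k * b
  copies≤ = begin
    (n ^ d) ^ k               ≤⟨ ^-monoˡ-≤ k (^-monoˡ-≤ d n≤[2r]^D) ⟩
    (((2 * r) ^ D) ^ d) ^ k   ≡⟨ trans (cong (_^ k) (^-*-assoc (2 * r) D d)) (^-*-assoc (2 * r) (D * d) k) ⟩
    (2 * r) ^ (D * d * k)     ≡⟨ cong ((2 * r) ^_) (exponent D d k) ⟩
    (2 * r) ^ (k * d ^ k)     ≡⟨ ^-distrib-* 2 r (k * d ^ k) ⟩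
    b * r ^ (k * d ^ k)       ≡⟨ *-comm b (r ^ (k * d ^ k)) ⟩
    r ^ (k * d ^ k) * b       ≡⟨ cong (_* b) (^-*-assoc r k (d ^ k)) ⟨
    (r ^ k) ^ d ^ k * b       ∎
    where
    1+r≤2r : suc r ≤ 2 * r
    1+r≤2r = ≤-trans (+-monoˡ-≤ r (>-nonZero⁻¹ r)) (≤-reflexive (cong (r +_) (sym (+-identityʳ r))))
    n≤[2r]^D : n ≤ (2 * r) ^ D
    n≤[2r]^D = ≤-trans (<⇒≤ n<[1+r]^D) (^-monoˡ-≤ D 1+r≤2r)
    exponent : ∀ D d k → D * d * k ≡ k * (d * D)
    exponent = solve-∀

  twice≤nCk : ∀ X → (4 * k) ^ k * X ≤ n ^ k → 2 * X ≤ n C k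
  twice≤nCk X [4k]^k*X≤n^k = *-cancelˡ-≤ ((2 * k) ^ k) (begin
    (2 * k) ^ k * (2 * X)      ≡⟨ x∙yz≈yx∙z *-commutativeSemigroup ((2 * k) ^ k) 2 X ⟩
    2 * (2 * k) ^ k * X        ≤⟨ *-monoˡ-≤ X (*-monoˡ-≤ ((2 * k) ^ k) 2≤2^k) ⟩
    2 ^ k * (2 * k) ^ k * X    ≡⟨ cong (_* X) (^-distrib-* 2 (2 * k) k) ⟨
    (2 * (2 * k)) ^ k * X      ≡⟨ cong (λ y → y ^ k * X) (*-assoc 2 2 k) ⟨
    (4 * k) ^ k * X            ≤⟨ [4k]^k*X≤n^k ⟩
    n ^ k                      ≤⟨ n^k≤[2k]^k*nCk k n 2k≤n ⟩
    (2 * k) ^ k * (n C k)      ∎)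
    where
    instance _ = m^n≢0 (2 * k) k
    2≤2^k : 2 ≤ 2 ^ k
    2≤2^k = ≤-trans (≤-reflexive (sym (*-identityʳ 2))) (^-monoʳ-≤ 2 (s≤s (z≤n {k₁})))
    2k≤n : 2 * k ≤ n
    2k≤n = ≤-trans (*-monoˡ-≤ k (s≤s (s≤s (z≤n {2})))) (≤-trans (m≤m*n (4 * k) r) 4kr≤n)

  edges≥ : r ^ k * b + r ^ k * t ^ k ≤ n C k
  edges≥ = *-cancelˡ-≤ 2 (begin
    2 * (r ^ k * b + r ^ k * t ^ k)       ≡⟨ *-distribˡ-+ 2 (r ^ k * b) (r ^ k * t ^ k) ⟩
    2 * (r ^ k * b) + 2 * (r ^ k * t ^ k) ≤⟨ +-mono-≤ (twice≤nCk _ [4k]^k*r^kb≤n^k) (twice≤nCk _ [4k]^k*r^kt^k≤n^k) ⟩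
    n C k + n C k                          ≡⟨ cong (n C k +_) (+-identityʳ (n C k)) ⟨
    2 * (n C k)                            ∎)
    where
    [4k]^k*r^kb≤n^k : (4 * k) ^ k * (r ^ k * b) ≤ n ^ k
    [4k]^k*r^kb≤n^k = begin
      (4 * k) ^ k * (r ^ k * b)       ≤⟨ *-monoʳ-≤ ((4 * k) ^ k) (*-monoʳ-≤ (r ^ k) b≤b^k) ⟩
      (4 * k) ^ k * (r ^ k * b ^ k)   ≡⟨ rearrange ((4 * k) ^ k) (r ^ k) (b ^ k) ⟩
      (4 * k) ^ k * b ^ k * r ^ k     ≡⟨ cong (_* r ^ k) (^-distrib-* (4 * k) b k) ⟨
      C₀ ^ k * r ^ k                  ≡⟨ ^-distrib-* C₀ r k ⟨
      (C₀ * r) ^ k                    ≤⟨ ^-monoˡ-≤ k C₀*r≤n ⟩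
      n ^ k                           ∎
      where
      rearrange : ∀ x y z → x * (y * z) ≡ x * z * y
      rearrange = solve-∀
      b≤b^k : b ≤ b ^ k
      b≤b^k = ≤-trans (≤-reflexive (sym (*-identityʳ b))) (^-monoʳ-≤ b (s≤s (z≤n {k₁})))
    [4k]^k*r^kt^k≤n^k : (4 * k) ^ k * (r ^ k * t ^ k) ≤ n ^ k
    [4k]^k*r^kt^k≤n^k = begin
      (4 * k) ^ k * (r ^ k * t ^ k)   ≡⟨ cong ((4 * k) ^ k *_) (^-distrib-* r t k) ⟨
      (4 * k) ^ k * (r * t) ^ k       ≡⟨ ^-distrib-* (4 * k) (r * t) k ⟨
      (4 * k * (r * t)) ^ k           ≡⟨ cong (_^ k) (rearrange (4 * k) r t) ⟩
      (t * (4 * k * r)) ^ k           ≤⟨ ^-monoˡ-≤ k t*4kr≤n ⟩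
      n ^ k                           ∎
      where
      rearrange : ∀ x r t → x * (r * t) ≡ t * (x * r)
      rearrange = solve-∀

  growth : 1 ^ D * n ^ (k * D ∸ k) ≤ ((8 * k) ^ k) ^ D * (t ^ k) ^ D
  growth = begin
    1 ^ D * n ^ (k * D ∸ k)          ≡⟨ trans (cong (_* n ^ (k * D ∸ k)) (^-zeroˡ D)) (*-identityˡ _) ⟩
    n ^ (k * D ∸ k)                  ≤⟨ *-cancelʳ-≤ _ _ (n ^ k) n^kD≤ ⟩
    ((8 * k) ^ k) ^ D * (t ^ k) ^ D  ∎
    where
    instance
      _ = >-nonZero (≤-trans (>-nonZero⁻¹ (4 * k * r)) 4kr≤n)
      _ = m^n≢0 n k
    k≤kD : k ≤ k * D
    k≤kD = m≤m*n k D
      where instance _ = >-nonZero (≤-trans (s≤s z≤n) 2≤D)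
    n^kD≤ : n ^ (k * D ∸ k) * n ^ k ≤ ((8 * k) ^ k) ^ D * (t ^ k) ^ D * n ^ k
    n^kD≤ = begin
      n ^ (k * D ∸ k) * n ^ k             ≡⟨ ^-distribˡ-+-* n (k * D ∸ k) k ⟨
      n ^ (k * D ∸ k + k)                 ≡⟨ cong (n ^_) (m∸n+n≡m k≤kD) ⟩
      n ^ (k * D)                         ≤⟨ ^-monoˡ-≤ (k * D) n≤8kt*r ⟩
      (8 * k * t * r) ^ (k * D)           ≡⟨ ^-distrib-* (8 * k * t) r (k * D) ⟩
      (8 * k * t) ^ (k * D) * r ^ (k * D) ≡⟨ cong₂ _*_ (^-distrib-* (8 * k) t (k * D)) r^kD≡[r^D]^k ⟩
      (8 * k) ^ (k * D) * t ^ (k * D) * (r ^ D) ^ k ≤⟨ *-monoʳ-≤ ((8 * k) ^ (k * D) * t ^ (k * D)) (^-monoˡ-≤ k r^D≤n) ⟩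
      (8 * k) ^ (k * D) * t ^ (k * D) * n ^ k ≡⟨ cong (_* n ^ k) (cong₂ _*_ (^-*-assoc (8 * k) k D) (^-*-assoc t k D)) ⟨
      ((8 * k) ^ k) ^ D * (t ^ k) ^ D * n ^ k ∎
      where
      r^kD≡[r^D]^k : r ^ (k * D) ≡ (r ^ D) ^ k
      r^kD≡[r^D]^k = trans (cong (r ^_) (*-comm k D)) (sym (^-*-assoc r D k))

exAtLeast-growth : ∀ k₁ d → 1 ≤ k₁ → 2 ≤ d → ∀ n → threshold (suc k₁) d ≤ n →
  Σ ℕ λ m → ExAtLeast n (suc k₁) d m ×
    (1 ^ d ^ k₁ * n ^ (suc k₁ * d ^ k₁ ∸ suc k₁) ≤ ((8 * suc k₁) ^ suc k₁) ^ d ^ k₁ * m ^ d ^ k₁)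
exAtLeast-growth k₁ d@(suc _) 1≤k₁ 2≤d n threshold≤n with root (d ^ k₁) {{m^n≢0 d k₁}} n
... | zero      , _     , n<1       =
  contradiction (≤-trans (0<threshold k₁ d) threshold≤n) (<⇒≱ (subst (n <_) (^-zeroˡ (d ^ k₁)) n<1))
... | r@(suc _) , r^D≤n , n<[1+r]^D =
  t ^ k , Deletion.deletion (r ^ k) {{m^n≢0 r k}} n k d zero b (t ^ k) copies≤ edges≥ , growth
  where open Choice k₁ d n r 1≤k₁ 2≤d threshold≤n r^D≤n n<[1+r]^D

proposition3p1 : ((k : ℕ) → 2 ≤ k →
    Σ ℕ λ a → Σ ℕ λ b → 0 < a × 0 < b ×
    ((d : ℕ) → 2 ≤ d → ∃ λ N → (n : ℕ) → N ≤ n →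
    Σ ℕ λ m → ExAtLeast n k d m ×
    (a ^ (d ^ (k ∸ 1)) * n ^ (k * d ^ (k ∸ 1) ∸ k) ≤ b ^ (d ^ (k ∸ 1)) * m ^ (d ^ (k ∸ 1)))))
    ×
    ((d k : ℕ) → 2 ≤ d → 2 ≤ k → SkelDegeneracyIs k d ((k ∸ 1) * d))
proposition3p1 =
  (λ { (suc k₁) (s≤s 1≤k₁) → 1 , (8 * suc k₁) ^ suc k₁ , s≤s z≤n , m^n>0 (8 * suc k₁) (suc k₁) ,
       λ d 2≤d → threshold (suc k₁) d , exAtLeast-growth k₁ d 1≤k₁ 2≤d }) ,
  λ { (suc d₁) (suc k₁) _ _ → skelDegeneracy k₁ d₁ }
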